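{- Let $A$ be a countably infinite poset and let $p \in \lambda(A)$. (i) There is a finite $V_0 \subseteq A$ with $V_0^- = V_p$ if and only if $p$ is not an upper limit of $\lambda(A)$. (ii) There is a finite $W_0 \subseteq A$ with $W_0^+ = W_p$ if and only if $p$ is not a lower limit of $\lambda(A)$.
   Context: For $Q \subseteq A$: $Q^- = \{v \in A : \exists w \in Q,\ v \le w\}$, $Q^+ = \{v \in A : \exists w\in Q,\ v \ge w\}$. An external type $p$ over $A$ is the type over $A$ of the new point $e$ of a one-point extension $A\cup\{e\}$, identified with the partition $(U_p,V_p,W_p)$ of $A$, $U_p = \{a : a<e\}$, $V_p = \{a : a \text{ incomparable to } e\}$, $W_p = \{a: a>e\}$; $\eta(A)$ is the set of these. Topology: basic open sets, for finite $A_0 \subseteq A$ and external type $(U_0,V_0,W_0)$ over $A_0$, are $\{p : U_0 \subseteq U_p, V_0 \subseteq V_p, W_0 \subseteq W_p\}$. $(p,q)$ is $<$-valid if there is a poset $A\cup\{b,c\}$ extending $A$ ($b\neq c$ new) with $b$ of type $p$, $c$ of type $q$, $b < c$; $p \ll q$ iff $p\ne q$ and $(p,q)$ is $<$-valid. $\lambda(A) = \{p \in \eta(A) : U_p = \varnothing\}$. For $\theta\subseteq \eta(A)$, $p$ is an upper limit of $\theta$ if every open $O \ni p$ contains some $r \in \theta$ with $r \ll p$; a lower limit if every open $O \ni p$ contains some $r \in\theta$ with $p \ll r$. -}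

module Defs where

open import Level using (0ℓ)
open import Data.Sum using (_⊎_; inj₁; inj₂)
open import Data.Unit using (⊤; tt)
open import Data.Bool using (Bool; true; false)
open import Data.Product using (Σ; _×_; _,_)
open import Data.List using (List)
open import Data.List.Membership.Propositional using (_∈_)
open import Relation.Binary.Structures using (IsPartialOrder)
open import Relation.Binary.PropositionalEquality using (_≡_; _≢_)
open import Relation.Nullary using (¬_)
open import Function.Bundles using (_⇔_)

module _ {A : Set} (_≤_ : A → A → Set) where

  Extends : {X : Set} → (A → X) → (X → X → Set) → Set
  Extends ι R = ∀ a b → (R (ι a) (ι b) ⇔ (a ≤ b))

  TypeOfPoint : {X : Set} → (A → X) → (X → X → Set) → X →
                (A → Set) → (A → Set) → (A → Set) → Set
  TypeOfPoint ι R x U V W =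
    ∀ a → (U a ⇔ (R (ι a) x × ι a ≢ x))
        × (V a ⇔ (¬ R (ι a) x × ¬ R x (ι a)))
        × (W a ⇔ (R x (ι a) × x ≢ ι a))

  -- External type over A: the type of the new point e = inj₂ tt of a
  -- one-point extension A ∪ {e} (a poset on A ⊎ ⊤ extending A),
  -- identified with the partition (U, V, W).
  record ExtType : Set₁ where
    field
      U V W : A → Set
      realized : Σ (A ⊎ ⊤ → A ⊎ ⊤ → Set) λ (R : A ⊎ ⊤ → A ⊎ ⊤ → Set) →
                   IsPartialOrder _≡_ R × Extends inj₁ R
                   × TypeOfPoint inj₁ R (inj₂ tt) U V W
  open ExtType public

  -- The order on A0 ∪ {e} is a
  -- relation R on A ⊎ ⊤ whose partial-order axioms are required only on
  -- the elements of A0 ∪ {e}.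
  InSub : List A → A ⊎ ⊤ → Set
  InSub A0 (inj₁ a) = a ∈ A0
  InSub A0 (inj₂ _) = ⊤

  ExtTypeOver : List A → (A → Set) → (A → Set) → (A → Set) → Set₁
  ExtTypeOver A0 U0 V0 W0 =
    (∀ a → U0 a → a ∈ A0) × (∀ a → V0 a → a ∈ A0) × (∀ a → W0 a → a ∈ A0)
    × Σ (A ⊎ ⊤ → A ⊎ ⊤ → Set) λ (R : A ⊎ ⊤ → A ⊎ ⊤ → Set) →
        (∀ x → InSub A0 x → R x x)
      × (∀ x y → InSub A0 x → InSub A0 y → R x y → R y x → x ≡ y)
      × (∀ x y z → InSub A0 x → InSub A0 y → InSub A0 z →
           R x y → R y z → R x z)
      × (∀ a b → a ∈ A0 → b ∈ A0 → (R (inj₁ a) (inj₁ b) ⇔ (a ≤ b)))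
      × (∀ a → a ∈ A0 →
           (U0 a ⇔ (R (inj₁ a) (inj₂ tt) × _≢_ {A = A ⊎ ⊤} (inj₁ a) (inj₂ tt)))
         × (V0 a ⇔ (¬ R (inj₁ a) (inj₂ tt) × ¬ R (inj₂ tt) (inj₁ a)))
         × (W0 a ⇔ (R (inj₂ tt) (inj₁ a) × _≢_ {A = A ⊎ ⊤} (inj₂ tt) (inj₁ a))))

  record BasicOpen : Set₁ where
    field
      A0 : List A
      U0 V0 W0 : A → Set
      isType : ExtTypeOver A0 U0 V0 W0
  open BasicOpen public

  _∈O_ : ExtType → BasicOpen → Set
  p ∈O O = (∀ a → U0 O a → U p a) × (∀ a → V0 O a → V p a)
         × (∀ a → W0 O a → W p a)

  _≈ₜ_ : ExtType → ExtType → Set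
  p ≈ₜ q = ∀ a → (U p a ⇔ U q a) × (V p a ⇔ V q a) × (W p a ⇔ W q a)

  LtValid : ExtType → ExtType → Set₁
  LtValid p q = Σ (A ⊎ Bool → A ⊎ Bool → Set) λ (R : A ⊎ Bool → A ⊎ Bool → Set) →
      IsPartialOrder _≡_ R × Extends inj₁ R
    × TypeOfPoint inj₁ R (inj₂ false) (U p) (V p) (W p)
    × TypeOfPoint inj₁ R (inj₂ true) (U q) (V q) (W q)
    × R (inj₂ false) (inj₂ true) × _≢_ {A = A ⊎ Bool} (inj₂ false) (inj₂ true)

  _≪_ : ExtType → ExtType → Set₁
  p ≪ q = ¬ (p ≈ₜ q) × LtValid p q

  InLambda : ExtType → Set
  InLambda p = ∀ a → ¬ U p a

  -- upper / lower limits of θ (θ a predicate on external types); it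
  -- suffices to quantify over basic open neighbourhoods
  UpperLimit : (ExtType → Set) → ExtType → Set₁
  UpperLimit θ p = (O : BasicOpen) → p ∈O O →
    Σ ExtType λ r → θ r × r ∈O O × (r ≪ p)

  LowerLimit : (ExtType → Set) → ExtType → Set₁
  LowerLimit θ p = (O : BasicOpen) → p ∈O O →
    Σ ExtType λ r → θ r × r ∈O O × (p ≪ r)

  Down : List A → A → Set
  Down Q v = Σ A λ w → w ∈ Q × v ≤ w

  Up : List A → A → Set
  Up Q v = Σ A λ w → w ∈ Q × w ≤ v

-- On λ(A) an external type p is determined by the up-set W_p, its complement
-- being V_p, and r ≪ q holds exactly when W_q ⊊ W_r: any such pair is realised by
-- placing a two-element chain b < c below A, b under W_r and c under W_q.
-- A basic neighbourhood of p constrains only a finite set L ⊆ V_p (and a finite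
-- part of W_p).  The λ-type with V-part L⁻ lies in that neighbourhood and is ≪ p
-- unless L⁻ = V_p; conversely, if V_p = V₀⁻, the neighbourhood forcing V₀ into the
-- V-part forces all of V_p into it, so nothing there is strictly ≪ p.  Lower limits
-- are the same argument with W, L⁺ and upward closure.
{-# OPTIONS --safe #-}
module Submission where

open import Defs
open import Level using (0ℓ; suc; Lift; lift; lower)
open import Axiom.ExcludedMiddle using (ExcludedMiddle)
open import Data.Nat using (ℕ)
open import Data.Product using (Σ; _×_; _,_; proj₁; proj₂)
open import Data.List using (List; filter)
open import Data.List.Membership.Propositional using (_∈_)
open import Data.List.Membership.Propositional.Properties using (∈-filter⁺; ∈-filter⁻)
open import Data.Sum using (_⊎_; inj₁; inj₂)
open import Data.Unit using (tt)
import Data.Unit.Properties as Unit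
open import Data.Bool using (Bool; true; false; f≤t; b≤b)
import Data.Bool as Bool
import Data.Bool.Properties as Bool
open import Data.Empty using (⊥; ⊥-elim)
open import Function using (id; _∘_; flip)
open import Function.Bundles using (_⇔_; _↔_; mk⇔; Equivalence)
open import Function.Construct.Composition using (_⇔-∘_)
open import Relation.Binary.Core using (Rel)
open import Relation.Binary.Definitions using (_Respects_)
open import Relation.Binary.Structures using (IsPartialOrder)
open import Relation.Binary.PropositionalEquality using (_≡_; refl; cong; isEquivalence)
open import Relation.Nullary using (¬_; Dec)
open import Relation.Nullary.Decidable using (map′; decidable-stable)
open import Relation.Unary using (Pred; _⊆_; ∁)

open Equivalence using (to; from)

module _ {A : Set} {_≤_ : Rel A 0ℓ} where

  W-upClosed : (q : ExtType _≤_) → W q Respects _≤_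
  W-upClosed record { realized = _ , R-po , ext , typ } {a} {b} a≤b Wa =
    let (_ , _ , W⇔) = typ a ; (_ , _ , W⇔′) = typ b
    in from W⇔′ (IsPartialOrder.trans R-po (proj₁ (to W⇔ Wa)) (from (ext a b) a≤b) , λ ())

  V⇒¬W : (q : ExtType _≤_) → V q ⊆ ∁ (W q)
  V⇒¬W record { realized = _ , _ , _ , typ } {a} Va Wa =
    let (_ , V⇔ , W⇔) = typ a in proj₂ (to V⇔ Va) (proj₁ (to W⇔ Wa))

  LtValid⇒W⊇ : (q r : ExtType _≤_) → LtValid _≤_ q r → W r ⊆ W q
  LtValid⇒W⊇ q r (_ , R-po , _ , tq , tr , q<r , _) {a} Wr =
    let (_ , _ , W⇔q) = tq a ; (_ , _ , W⇔r) = tr a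
    in from W⇔q (IsPartialOrder.trans R-po q<r (proj₁ (to W⇔r Wr)) , λ ())

  restrict : ExtType _≤_ → List A → BasicOpen _≤_
  restrict q@record { realized = R , R-po , ext , typ } L = record
    { A0 = L
    ; U0 = λ a → U q a × a ∈ L
    ; V0 = λ a → V q a × a ∈ L
    ; W0 = λ a → W q a × a ∈ L
    ; isType = (λ _ → proj₂) , (λ _ → proj₂) , (λ _ → proj₂) , R
             , (λ _ _ → IsPartialOrder.refl R-po)
             , (λ _ _ _ _ → IsPartialOrder.antisym R-po)
             , (λ _ _ _ _ _ _ → IsPartialOrder.trans R-po)
             , (λ a b _ _ → ext a b)
             , λ a a∈L → let (U⇔ , V⇔ , W⇔) = typ a
                         in restrict⇔ a∈L U⇔ , restrict⇔ a∈L V⇔ , restrict⇔ a∈L W⇔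
    }
    where
    restrict⇔ : ∀ {a} {P Q : Set} → a ∈ L → P ⇔ Q → (P × a ∈ L) ⇔ Q
    restrict⇔ a∈L P⇔Q = mk⇔ (to P⇔Q ∘ proj₁) (λ Q → from P⇔Q Q , a∈L)

  ∈O-restrict : (q : ExtType _≤_) (L : List A) → _∈O_ _≤_ q (restrict q L)
  ∈O-restrict q L = (λ _ → proj₁) , (λ _ → proj₁) , (λ _ → proj₁)

  Down-least : ∀ {S : Pred A 0ℓ} {L} → S Respects flip _≤_ →
               (∀ {w} → w ∈ L → S w) → Down _≤_ L ⊆ S
  Down-least S-down L⊆S (w , w∈L , a≤w) = S-down a≤w (L⊆S w∈L)

  Up-least : ∀ {S : Pred A 0ℓ} {L} → S Respects _≤_ →
             (∀ {w} → w ∈ L → S w) → Up _≤_ L ⊆ S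
  Up-least S-up L⊆S (w , w∈L , w≤a) = S-up w≤a (L⊆S w∈L)

  module _ (q : ExtType _≤_) (q∈λ : InLambda _≤_ q) where

    ¬W⇒V : ∁ (W q) ⊆ V q
    ¬W⇒V {a} ¬Wa =
      let (_ , _ , _ , typ) = realized q ; (U⇔ , V⇔ , W⇔) = typ a
      in from V⇔ ( (λ a<e → q∈λ a (from U⇔ (a<e , λ ())))
                 , (λ e<a → ¬Wa (from W⇔ (e<a , λ ()))))

    V⇔¬W : ∀ a → V q a ⇔ (¬ W q a)
    V⇔¬W a = mk⇔ (V⇒¬W q) ¬W⇒V

    V-downClosed : V q Respects flip _≤_
    V-downClosed b≤a Va = ¬W⇒V (V⇒¬W q Va ∘ W-upClosed q b≤a)

  W≐⇒≈ : (q r : ExtType _≤_) → InLambda _≤_ q → InLambda _≤_ r →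
         W q ⊆ W r → W r ⊆ W q → _≈ₜ_ _≤_ q r
  W≐⇒≈ q r q∈λ r∈λ Wq⊆Wr Wr⊆Wq a =
      mk⇔ (⊥-elim ∘ q∈λ a) (⊥-elim ∘ r∈λ a)
    , mk⇔ (λ Va → ¬W⇒V r r∈λ (V⇒¬W q Va ∘ Wr⊆Wq))
          (λ Va → ¬W⇒V q q∈λ (V⇒¬W r Va ∘ Wq⊆Wr))
    , mk⇔ Wq⊆Wr Wr⊆Wq

module Glue {A B : Set} {_≤_ : Rel A 0ℓ} {_⊑_ : Rel B 0ℓ} (S : B → Pred A 0ℓ) where

  _⊴_ : Rel (A ⊎ B) 0ℓ
  inj₁ a ⊴ inj₁ b = a ≤ b
  inj₁ _ ⊴ inj₂ _ = ⊥
  inj₂ x ⊴ inj₁ b = S x b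
  inj₂ x ⊴ inj₂ y = x ⊑ y

  ⊴-isPartialOrder : IsPartialOrder _≡_ _≤_ → IsPartialOrder _≡_ _⊑_ →
    (∀ x → S x Respects _≤_) → (∀ {x y} → x ⊑ y → S y ⊆ S x) → IsPartialOrder _≡_ _⊴_
  ⊴-isPartialOrder ≤-po ⊑-po S-up S-anti = record
    { isPreorder = record
      { isEquivalence = isEquivalence
      ; reflexive = λ { {x} refl → ⊴-refl x }
      ; trans = λ {x} {y} {z} → ⊴-trans x y z }
    ; antisym = λ {x} {y} → ⊴-antisym x y }
    where
    module ≤ = IsPartialOrder ≤-po
    module ⊑ = IsPartialOrder ⊑-po

    ⊴-refl : ∀ x → x ⊴ x
    ⊴-refl (inj₁ a) = ≤.refl
    ⊴-refl (inj₂ x) = ⊑.refl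

    ⊴-trans : ∀ x y z → x ⊴ y → y ⊴ z → x ⊴ z
    ⊴-trans (inj₁ _) (inj₁ _) (inj₁ _) a≤b b≤c = ≤.trans a≤b b≤c
    ⊴-trans (inj₂ x) (inj₁ _) (inj₁ _) Sb b≤c = S-up x b≤c Sb
    ⊴-trans (inj₂ _) (inj₂ _) (inj₁ _) x⊑y Sc = S-anti x⊑y Sc
    ⊴-trans (inj₂ _) (inj₂ _) (inj₂ _) x⊑y y⊑z = ⊑.trans x⊑y y⊑z
    ⊴-trans (inj₁ _) (inj₂ _) _ () _
    ⊴-trans _ (inj₁ _) (inj₂ _) _ ()

    ⊴-antisym : ∀ x y → x ⊴ y → y ⊴ x → x ≡ y
    ⊴-antisym (inj₁ _) (inj₁ _) a≤b b≤a = cong inj₁ (≤.antisym a≤b b≤a)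
    ⊴-antisym (inj₂ _) (inj₂ _) x⊑y y⊑x = cong inj₂ (⊑.antisym x⊑y y⊑x)
    ⊴-antisym (inj₁ _) (inj₂ _) () _
    ⊴-antisym (inj₂ _) (inj₁ _) _ ()

  ⊴-extends : Extends _≤_ inj₁ _⊴_
  ⊴-extends a b = mk⇔ id id

  typeOf-inj₂ : ∀ x → TypeOfPoint _≤_ inj₁ _⊴_ (inj₂ x) (λ _ → ⊥) (∁ (S x)) (S x)
  typeOf-inj₂ x a =
    mk⇔ ⊥-elim proj₁ , mk⇔ (λ ¬Sa → (λ ()) , ¬Sa) proj₂ , mk⇔ (λ Sa → Sa , λ ()) proj₁

module _ {A : Set} {_≤_ : Rel A 0ℓ} (≤-po : IsPartialOrder _≡_ _≤_) where
  open IsPartialOrder ≤-po using () renaming (refl to ≤-refl; trans to ≤-trans)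

  Down-downClosed : (L : List A) → Down _≤_ L Respects flip _≤_
  Down-downClosed L b≤a (w , w∈L , a≤w) = w , w∈L , ≤-trans b≤a a≤w

  Up-upClosed : (L : List A) → Up _≤_ L Respects _≤_
  Up-upClosed L a≤b (w , w∈L , w≤a) = w , w∈L , ≤-trans w≤a a≤b

  λType : (S : Pred A 0ℓ) → S Respects _≤_ → ExtType _≤_
  λType S S-up = record
    { U = λ _ → ⊥ ; V = ∁ S ; W = S
    ; realized = _⊴_ , ⊴-isPartialOrder ≤-po Unit.≡-isPartialOrder (λ _ → S-up) (λ { refl → id })
               , ⊴-extends , typeOf-inj₂ tt }
    where open Glue {_≤_ = _≤_} {_⊑_ = _≡_} (λ _ → S)

  ⊇⇒LtValid : (q r : ExtType _≤_) → InLambda _≤_ q → InLambda _≤_ r →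
              W r ⊆ W q → LtValid _≤_ q r
  ⊇⇒LtValid q r q∈λ r∈λ Wr⊆Wq =
      _⊴_ , ⊴-isPartialOrder ≤-po Bool.≤-isPartialOrder (W-upClosed ∘ S) (λ { f≤t → Wr⊆Wq ; b≤b → id })
    , ⊴-extends , asType false q∈λ , asType true r∈λ , f≤t , λ ()
    where
    S : Bool → ExtType _≤_
    S false = q
    S true  = r
    open Glue {_≤_ = _≤_} {_⊑_ = Bool._≤_} (W ∘ S)

    asType : ∀ x → InLambda _≤_ (S x) →
             TypeOfPoint _≤_ inj₁ _⊴_ (inj₂ x) (U (S x)) (V (S x)) (W (S x))
    asType x Sx∈λ a =
      let (U⇔ , V⇔ , W⇔) = typeOf-inj₂ x a
      in U⇔ ⇔-∘ mk⇔ (Sx∈λ a) ⊥-elim , V⇔ ⇔-∘ V⇔¬W (S x) Sx∈λ a , W⇔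

  ≪⇔W⊃ : (q r : ExtType _≤_) → InLambda _≤_ q → InLambda _≤_ r →
         _≪_ _≤_ q r ⇔ (W r ⊆ W q × ¬ (W q ⊆ W r))
  ≪⇔W⊃ q r q∈λ r∈λ = mk⇔
    (λ (q≉r , q<r) → let Wr⊆Wq = LtValid⇒W⊇ q r q<r
                     in Wr⊆Wq , λ Wq⊆Wr → q≉r (W≐⇒≈ q r q∈λ r∈λ Wq⊆Wr Wr⊆Wq))
    (λ (Wr⊆Wq , Wq⊈Wr) → (λ q≈r → Wq⊈Wr λ {a} → to (proj₂ (proj₂ (q≈r a))))
                        , ⊇⇒LtValid q r q∈λ r∈λ Wr⊆Wq)

module Classical (em : ExcludedMiddle (suc 0ℓ)) where

  dec : (P : Set) → Dec P
  dec P = map′ lower lift (em {Lift (suc 0ℓ) P})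

  dne : {P : Set} → ¬ ¬ P → P
  dne = decidable-stable (dec _)

  sublist : {A : Set} → Pred A 0ℓ → List A → List A
  sublist P = filter (dec ∘ P)

  ∈-sublist : {A : Set} {P : Pred A 0ℓ} {L : List A} → (∀ a → P a → a ∈ L) →
              ∀ {a} → a ∈ sublist P L ⇔ P a
  ∈-sublist {P = P} {L} P⊆L =
    mk⇔ (proj₂ ∘ ∈-filter⁻ (dec ∘ P) {xs = L}) (λ Pa → ∈-filter⁺ (dec ∘ P) (P⊆L _ Pa) Pa)

module InLambdaPoint (em : ExcludedMiddle (suc 0ℓ)) {A : Set} {_≤_ : Rel A 0ℓ}
                     (≤-po : IsPartialOrder _≡_ _≤_) (p : ExtType _≤_) (p∈λ : InLambda _≤_ p) where
  open Classical em
  open IsPartialOrder ≤-po using () renaming (refl to ≤-refl)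

  FinitelyDownGenerated : Pred A 0ℓ → Set
  FinitelyDownGenerated S = Σ (List A) λ L → ∀ a → Down _≤_ L a ⇔ S a

  FinitelyUpGenerated : Pred A 0ℓ → Set
  FinitelyUpGenerated S = Σ (List A) λ L → ∀ a → Up _≤_ L a ⇔ S a

  downGenerated⇒¬upperLimit : FinitelyDownGenerated (V p) → ¬ UpperLimit _≤_ (InLambda _≤_) p
  downGenerated⇒¬upperLimit (V₀ , V₀⁻⇔Vp) upper
    with upper (restrict p V₀) (∈O-restrict p V₀)
  ... | r , r∈λ , (_ , V₀⊆Vr , _) , r≪p = proj₂ (to (≪⇔W⊃ ≤-po r p r∈λ p∈λ) r≪p) Wr⊆Wp
    where
    V₀⊆Vp : ∀ {w} → w ∈ V₀ → V p w
    V₀⊆Vp {w} w∈V₀ = to (V₀⁻⇔Vp w) (w , w∈V₀ , ≤-refl)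

    Vp⊆Vr : V p ⊆ V r
    Vp⊆Vr {a} = Down-least (V-downClosed r r∈λ) (λ {w} w∈V₀ → V₀⊆Vr w (V₀⊆Vp w∈V₀ , w∈V₀))
              ∘ from (V₀⁻⇔Vp a)

    Wr⊆Wp : W r ⊆ W p
    Wr⊆Wp Wra = dne (λ ¬Wpa → V⇒¬W r (Vp⊆Vr (¬W⇒V p p∈λ ¬Wpa)) Wra)

  upGenerated⇒¬lowerLimit : FinitelyUpGenerated (W p) → ¬ LowerLimit _≤_ (InLambda _≤_) p
  upGenerated⇒¬lowerLimit (W₀ , W₀⁺⇔Wp) lower
    with lower (restrict p W₀) (∈O-restrict p W₀)
  ... | r , r∈λ , (_ , _ , W₀⊆Wr) , p≪r = proj₂ (to (≪⇔W⊃ ≤-po p r p∈λ r∈λ) p≪r) Wp⊆Wr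
    where
    W₀⊆Wp : ∀ {w} → w ∈ W₀ → W p w
    W₀⊆Wp {w} w∈W₀ = to (W₀⁺⇔Wp w) (w , w∈W₀ , ≤-refl)

    Wp⊆Wr : W p ⊆ W r
    Wp⊆Wr {a} = Up-least (W-upClosed r) (λ {w} w∈W₀ → W₀⊆Wr w (W₀⊆Wp w∈W₀ , w∈W₀))
              ∘ from (W₀⁺⇔Wp a)

  ¬downGenerated⇒upperLimit : ¬ FinitelyDownGenerated (V p) → UpperLimit _≤_ (InLambda _≤_) p
  ¬downGenerated⇒upperLimit ¬gen O (U₀⊆Up , V₀⊆Vp , W₀⊆Wp) = r , (λ _ ()) , r∈O , r≪p
    where
    L : List A
    L = sublist (V0 O) (A0 O)

    L⇔V₀ : ∀ {a} → a ∈ L ⇔ V0 O a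
    L⇔V₀ = ∈-sublist (proj₁ (proj₂ (isType O)))

    L⁻⊆Vp : Down _≤_ L ⊆ V p
    L⁻⊆Vp = Down-least (V-downClosed p p∈λ) (λ {w} → V₀⊆Vp w ∘ to L⇔V₀)

    Wp⊆∁L⁻ : W p ⊆ ∁ (Down _≤_ L)
    Wp⊆∁L⁻ Wpa L⁻a = V⇒¬W p (L⁻⊆Vp L⁻a) Wpa

    r : ExtType _≤_
    r = λType ≤-po (∁ (Down _≤_ L)) λ a≤b ∁L⁻a L⁻b → ∁L⁻a (Down-downClosed ≤-po L a≤b L⁻b)

    r∈O : _∈O_ _≤_ r O
    r∈O = (λ a → p∈λ a ∘ U₀⊆Up a)
        , (λ a V₀a ∁L⁻a → ∁L⁻a (a , from L⇔V₀ V₀a , ≤-refl))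
        , (λ a → Wp⊆∁L⁻ ∘ W₀⊆Wp a)

    r≪p : _≪_ _≤_ r p
    r≪p = from (≪⇔W⊃ ≤-po r p (λ _ ()) p∈λ)
      (Wp⊆∁L⁻ , λ ∁L⁻⊆Wp → ¬gen (L , λ a → mk⇔ L⁻⊆Vp (λ Vpa → dne (V⇒¬W p Vpa ∘ ∁L⁻⊆Wp))))

  ¬upGenerated⇒lowerLimit : ¬ FinitelyUpGenerated (W p) → LowerLimit _≤_ (InLambda _≤_) p
  ¬upGenerated⇒lowerLimit ¬gen O (U₀⊆Up , V₀⊆Vp , W₀⊆Wp) = r , (λ _ ()) , r∈O , p≪r
    where
    L : List A
    L = sublist (W0 O) (A0 O)

    L⇔W₀ : ∀ {a} → a ∈ L ⇔ W0 O a
    L⇔W₀ = ∈-sublist (proj₁ (proj₂ (proj₂ (isType O))))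

    L⁺⊆Wp : Up _≤_ L ⊆ W p
    L⁺⊆Wp = Up-least (W-upClosed p) (λ {w} → W₀⊆Wp w ∘ to L⇔W₀)

    r : ExtType _≤_
    r = λType ≤-po (Up _≤_ L) (Up-upClosed ≤-po L)

    r∈O : _∈O_ _≤_ r O
    r∈O = (λ a → p∈λ a ∘ U₀⊆Up a)
        , (λ a V₀a L⁺a → V⇒¬W p (V₀⊆Vp a V₀a) (L⁺⊆Wp L⁺a))
        , (λ a W₀a → a , from L⇔W₀ W₀a , ≤-refl)

    p≪r : _≪_ _≤_ p r
    p≪r = from (≪⇔W⊃ ≤-po p r p∈λ (λ _ ()))
      (L⁺⊆Wp , λ Wp⊆L⁺ → ¬gen (L , λ a → mk⇔ L⁺⊆Wp Wp⊆L⁺))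

lemma3p6 : ExcludedMiddle (suc 0ℓ) →
    {A : Set} (_≤_ : A → A → Set) → IsPartialOrder _≡_ _≤_ → A ↔ ℕ →
    (p : ExtType _≤_) → InLambda _≤_ p →
    ((Σ (List A) λ V₀ → ∀ a → (Down _≤_ V₀ a ⇔ V p a))
       ⇔ (¬ UpperLimit _≤_ (InLambda _≤_) p))
    × ((Σ (List A) λ W₀ → ∀ a → (Up _≤_ W₀ a ⇔ W p a))
       ⇔ (¬ LowerLimit _≤_ (InLambda _≤_) p))
lemma3p6 em _≤_ ≤-po _ p p∈λ =
    mk⇔ downGenerated⇒¬upperLimit (λ ¬upper → dne (¬upper ∘ ¬downGenerated⇒upperLimit))
  , mk⇔ upGenerated⇒¬lowerLimit (λ ¬lower → dne (¬lower ∘ ¬upGenerated⇒lowerLimit))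
  where
  open Classical em
  open InLambdaPoint em ≤-po p p∈λ
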